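{- Fix $n,K\in\mathbb{N}$ and a distribution $\tilde F$ on $[K]$, and let $F_k$ ($k\in[K]$) be $\tilde F$ conditioned on values at most $k$, i.e., $F_k(\ell)=\tilde F(\ell)/\tilde F(k)$ for $\ell\le k$ and $F_k(\ell)=1$ for $\ell>k$. If an online stopping algorithm for $n$ values (discrete time) accepts a value equal to $\max_i x_i$ with probability at least $\alpha$ when the values are i.i.d. from $F_K$, and with probability at least $\beta$ when they are i.i.d. from $F_k$ for every $k\in[K-1]$, then there is a minor-oblivious algorithm with the same two guarantees.
   Context: Discrete-time model: values $x_1,\dots,x_n$ are revealed in order; after seeing $x_t$ a (possibly randomized) algorithm irrevocably accepts (and stops) or rejects it, accepting at most one value; its decisions depend only on values observed so far and internal randomness. Success (MaxProb, all ties win) means the accepted value equals $\max_i x_i$. Let $\mathrm{ALG}$ be the index of the accepted value. For $t\in[n]$ and $\bm{x}_{1:t}\in[K]^t$, the conditional acceptance probability is $\mathrm{Acc}_t(\bm{x}_{1:t}) := \Pr[\mathrm{ALG}=t \mid \mathrm{ALG}\ge t,\ (x_1,\dots,x_t)=\bm{x}_{1:t}]$. An algorithm is minor-oblivious if $\mathrm{Acc}_t(\bm{x}_{1:t})=\mathrm{Acc}_t(\bm{y}_{1:t})$ whenever $x_t=y_t=\max\bm{x}_{1:t}=\max\bm{y}_{1:t}$.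
   Formalization: The distribution $\tilde F$ has rational probabilities, α and β are rational, and the conditional acceptance probabilities $\mathrm{Acc}_t$ of both the given and the constructed algorithm are rational. -}

module Defs where

open import Data.Nat as ℕ using (ℕ; zero; suc; _⊔_)
open import Data.Fin using (Fin; toℕ)
open import Data.List using (List; []; _∷_; _++_; [_]; map; foldr; concatMap; length)
open import Data.Rational using (ℚ; 0ℚ; 1ℚ; _+_; _*_; _-_; _≤_; 1/_; _≟_; ≢-nonZero)
open import Data.Bool using (Bool; if_then_else_)
open import Relation.Nullary using (yes; no; does)
open import Relation.Binary.PropositionalEquality using (_≡_)

-- Values are elements of Fin K; element ℓ represents the value toℕ ℓ + 1 ∈ [K].

allFin : (K : ℕ) → List (Fin K)
allFin K = Data.List.allFin K

allSeqs : (K : ℕ) → ℕ → List (List (Fin K))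
allSeqs K zero    = [] ∷ []
allSeqs K (suc n) = concatMap (λ x → map (x ∷_) (allSeqs K n)) (allFin K)

sumℚ : List ℚ → ℚ
sumℚ = foldr _+_ 0ℚ

prodℚ : List ℚ → ℚ
prodℚ = foldr _*_ 1ℚ

maxSeq : ∀ {K} → List (Fin K) → ℕ
maxSeq xs = foldr _⊔_ 0 (map toℕ xs)

record Distribution (K : ℕ) : Set where
  field
    pmf     : Fin K → ℚ
    nonneg  : ∀ ℓ → 0ℚ ≤ pmf ℓ
    sumOne  : sumℚ (map pmf (allFin K)) ≡ 1ℚ

cdf : ∀ {K} → (Fin K → ℚ) → Fin K → ℚ
cdf {K} p k = sumℚ (map (λ ℓ → if does (toℕ ℓ ℕ.≤? toℕ k) then p ℓ else 0ℚ) (allFin K))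

-- pmf of F_k : F̃ conditioned on values at most k.
-- (If F̃(k) = 0 the conditioning is undefined; we then use the zero measure.)
condPmf : ∀ {K} → (Fin K → ℚ) → Fin K → Fin K → ℚ
condPmf p k ℓ with cdf p k ≟ 0ℚ
... | yes _ = 0ℚ
... | no ne = if does (toℕ ℓ ℕ.≤? toℕ k)
                then p ℓ * (1/ cdf p k) {{≢-nonZero ne}}
                else 0ℚ

-- Online algorithms, given by their conditional acceptance probabilities
-- Acc(x_{1:t}) = Pr[ALG = t | ALG ≥ t, (x_1,…,x_t) = x_{1:t}]
-- (behavioural description of a randomized online stopping algorithm).

Algorithm : ℕ → Set
Algorithm K = List (Fin K) → ℚ

ValidAlg : ∀ {K} → Algorithm K → Set
ValidAlg acc = ∀ xs → (0ℚ ≤ acc xs) Data.Product.× (acc xs ≤ 1ℚ)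
  where import Data.Product

-- probability that the algorithm, run on the sequence `rest` after having
-- observed (and rejected) `prefix`, accepts a value equal to M
-- (ties all win).
winProb : ∀ {K} → Algorithm K → ℕ → List (Fin K) → List (Fin K) → ℚ
winProb acc M prefix []         = 0ℚ
winProb acc M prefix (x ∷ rest) =
  let a = acc (prefix ++ [ x ]) in
  (if does (toℕ x ℕ.≟ M) then a else 0ℚ)
    + (1ℚ - a) * winProb acc M (prefix ++ [ x ]) rest

successProb : ∀ {K} → ℕ → Algorithm K → (Fin K → ℚ) → ℚ
successProb {K} n acc q =
  sumℚ (map (λ xs → prodℚ (map q xs) * winProb acc (maxSeq xs) [] xs) (allSeqs K n))

MinorOblivious : ∀ {K} → ℕ → Algorithm K → Set
MinorOblivious {K} n acc =
  ∀ (xs ys : List (Fin K)) (a : Fin K) →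
  length xs ≡ length ys → suc (length xs) ℕ.≤ n →
  maxSeq (xs ++ [ a ]) ≡ toℕ a → maxSeq (ys ++ [ a ]) ≡ toℕ a →
  acc (xs ++ [ a ]) ≡ acc (ys ++ [ a ])

Guarantees : ∀ {K} → ℕ → Distribution K → ℚ → ℚ → Algorithm K → Set
Guarantees {K} n D α β acc =
  ∀ (k : Fin K) →
    (suc (toℕ k) ≡ K → α ≤ successProb n acc (condPmf (Distribution.pmf D) k))
    Data.Product.× (suc (toℕ k) ℕ.< K → β ≤ successProb n acc (condPmf (Distribution.pmf D) k))
  where import Data.Product

{-# OPTIONS --safe #-}
-- Let the new algorithm accept the t-th value ℓ, when the running maximum is M, with the average
-- acceptance probability of the given algorithm over all histories of length t - 1 leading to
-- (ℓ, M), each weighted by its F̃-probability of being seen without stopping. This rule depends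
-- only on t, ℓ and M, so it is minor-oblivious. By induction on t, using the tower property of
-- conditional expectation at each step, both algorithms have the same mass of "not stopped by
-- time t, with running maximum M", and the same mass of "stop at time t + 1 on value ℓ with
-- running maximum M". The probability of stopping on the overall maximum is a sum of the latter
-- masses, and conditioning F̃ to values ≤ k merely reweights each sequence by a function of its
-- maximum (and its length); so every success probability under every F_k is unchanged.
module Submission where

open import Defs
open import Data.Nat using (ℕ)
open import Data.Rational using (ℚ)
open import Data.Product using (Σ; _×_)

open import Data.Bool using (if_then_else_)
open import Data.Empty using (⊥-elim)
open import Data.Fin using (Fin; toℕ)
open import Data.Fin.Properties using (toℕ<n)
open import Data.List
  using (List; []; _∷_; _++_; [_]; _∷ʳ_; map; concatMap; length; downFrom; initLast; _∷ʳ′_)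
open import Data.List.Properties using (++-assoc)
open import Data.Maybe using (Maybe; just; nothing)
open import Data.Nat using (zero; suc; _⊔_)
import Data.Nat as ℕ
import Data.Nat.Properties as ℕₚ
open import Data.Product using (_,_; proj₁; proj₂)
open import Data.Rational
  using (0ℚ; 1ℚ; _+_; _*_; _-_; -_; _≤_; 1/_; _÷_; _≟_; NonZero; ≢-nonZero; nonNegative)
import Data.Rational.Properties as ℚ
open import Level using (0ℓ)
open import Relation.Binary.PropositionalEquality
  using (_≡_; refl; sym; trans; cong; cong₂; subst; subst₂; module ≡-Reasoning)
open import Relation.Nullary using (Dec; yes; no; does; ¬_)
open import Function using (_∘_)
open import Tactic.RingSolver using (solve)
import Tactic.RingSolver.Core.AlmostCommutativeRing as ACR
open import Algebra.Definitions.RawSemiring ℚ.+-*-rawSemiring using (_^_)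
open import Algebra.Properties.Group ℚ.+-0-group using (∙-cancelʳ)

open ≡-Reasoning

ℚ-ring : ACR.AlmostCommutativeRing 0ℓ 0ℓ
ℚ-ring = ACR.fromCommutativeRing ℚ.+-*-commutativeRing 0≟_
  where
  0≟_ : ∀ x → Maybe (0ℚ ≡ x)
  0≟ x with 0ℚ ≟ x
  ... | yes 0≡x = just 0≡x
  ... | no _    = nothing

∑ : {A : Set} → List A → (A → ℚ) → ℚ
∑ xs f = sumℚ (map f xs)

infix 5 ∑
syntax ∑ xs (λ x → e) = ∑[ x ∈ xs ] e

module _ {A : Set} where

  ∑-cong : (xs : List A) {f g : A → ℚ} → (∀ x → f x ≡ g x) → ∑ xs f ≡ ∑ xs g
  ∑-cong []       f≡g = refl
  ∑-cong (x ∷ xs) f≡g = cong₂ _+_ (f≡g x) (∑-cong xs f≡g)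

  ∑-++ : (xs ys : List A) (f : A → ℚ) → ∑ (xs ++ ys) f ≡ ∑ xs f + ∑ ys f
  ∑-++ []       ys f = sym (ℚ.+-identityˡ _)
  ∑-++ (x ∷ xs) ys f = trans (cong (f x +_) (∑-++ xs ys f)) (sym (ℚ.+-assoc (f x) _ _))

  ∑-zero : (xs : List A) → ∑[ _ ∈ xs ] 0ℚ ≡ 0ℚ
  ∑-zero []       = refl
  ∑-zero (x ∷ xs) = trans (cong (0ℚ +_) (∑-zero xs)) (ℚ.+-identityˡ 0ℚ)

  ∑-+ : (xs : List A) (f g : A → ℚ) → ∑[ x ∈ xs ] (f x + g x) ≡ ∑ xs f + ∑ xs g
  ∑-+ []       f g = refl
  ∑-+ (x ∷ xs) f g = trans (cong (f x + g x +_) (∑-+ xs f g)) (swap (f x) (g x) _ _)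
    where
    swap : ∀ a b c d → (a + b) + (c + d) ≡ (a + c) + (b + d)
    swap a b c d = solve (a ∷ b ∷ c ∷ d ∷ []) ℚ-ring

  ∑-*ˡ : (xs : List A) (c : ℚ) (f : A → ℚ) → ∑[ x ∈ xs ] c * f x ≡ c * ∑ xs f
  ∑-*ˡ []       c f = sym (ℚ.*-zeroʳ c)
  ∑-*ˡ (x ∷ xs) c f = trans (cong (c * f x +_) (∑-*ˡ xs c f)) (sym (ℚ.*-distribˡ-+ c (f x) _))

  ∑-mono-≤ : (xs : List A) {f g : A → ℚ} → (∀ x → f x ≤ g x) → ∑ xs f ≤ ∑ xs g
  ∑-mono-≤ []       f≤g = ℚ.≤-refl
  ∑-mono-≤ (x ∷ xs) f≤g = ℚ.+-mono-≤ (f≤g x) (∑-mono-≤ xs f≤g)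

  ∑-nonneg : (xs : List A) {f : A → ℚ} → (∀ x → 0ℚ ≤ f x) → 0ℚ ≤ ∑ xs f
  ∑-nonneg xs 0≤f = subst (_≤ ∑ xs _) (∑-zero xs) (∑-mono-≤ xs 0≤f)

module _ {A B : Set} where

  ∑-map : (h : A → B) (xs : List A) (f : B → ℚ) → ∑ (map h xs) f ≡ ∑[ x ∈ xs ] f (h x)
  ∑-map h []       f = refl
  ∑-map h (x ∷ xs) f = cong (f (h x) +_) (∑-map h xs f)

  ∑-concatMap : (g : A → List B) (xs : List A) (f : B → ℚ) →
    ∑ (concatMap g xs) f ≡ ∑[ x ∈ xs ] ∑ (g x) f
  ∑-concatMap g []       f = refl
  ∑-concatMap g (x ∷ xs) f =
    trans (∑-++ (g x) (concatMap g xs) f) (cong (∑ (g x) f +_) (∑-concatMap g xs f))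

  ∑-comm : (xs : List A) (ys : List B) (f : A → B → ℚ) →
    ∑[ x ∈ xs ] ∑[ y ∈ ys ] f x y ≡ ∑[ y ∈ ys ] ∑[ x ∈ xs ] f x y
  ∑-comm []       ys f = sym (∑-zero ys)
  ∑-comm (x ∷ xs) ys f =
    trans (cong (∑ ys (f x) +_) (∑-comm xs ys f)) (sym (∑-+ ys (f x) _))

  ∑-comm-* : (xs : List A) (ys : List B) (u : A → ℚ) (v : B → ℚ) (f : A → B → ℚ) →
    ∑[ x ∈ xs ] ∑[ y ∈ ys ] u x * (v y * f x y) ≡ ∑[ y ∈ ys ] v y * (∑[ x ∈ xs ] u x * f x y)
  ∑-comm-* xs ys u v f = trans (∑-comm xs ys _) (∑-cong ys λ y →
    trans (∑-cong xs λ x → exchange (u x) (v y) (f x y)) (∑-*ˡ xs (v y) _))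
    where
    exchange : ∀ a b c → a * (b * c) ≡ b * (a * c)
    exchange a b c = solve (a ∷ b ∷ c ∷ []) ℚ-ring

  ∑∑-+ : (xs : List A) (ys : List B) (f g : A → B → ℚ) →
    ∑[ x ∈ xs ] ∑[ y ∈ ys ] (f x y + g x y)
      ≡ (∑[ x ∈ xs ] ∑[ y ∈ ys ] f x y) + (∑[ x ∈ xs ] ∑[ y ∈ ys ] g x y)
  ∑∑-+ xs ys f g = trans (∑-cong xs λ x → ∑-+ ys (f x) (g x)) (∑-+ xs _ _)

𝟙 : {P : Set} → Dec P → ℚ
𝟙 P? = if does P? then 1ℚ else 0ℚ

if-then-0≡𝟙* : {P : Set} (P? : Dec P) (x : ℚ) → (if does P? then x else 0ℚ) ≡ 𝟙 P? * x
if-then-0≡𝟙* (yes _) x = sym (ℚ.*-identityˡ x)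
if-then-0≡𝟙* (no _)  x = sym (ℚ.*-zeroˡ x)

𝟙-yes : {P : Set} (P? : Dec P) → P → 𝟙 P? ≡ 1ℚ
𝟙-yes (yes _) _ = refl
𝟙-yes (no ¬p) p = ⊥-elim (¬p p)

𝟙-no : {P : Set} (P? : Dec P) → ¬ P → 𝟙 P? ≡ 0ℚ
𝟙-no (yes p) ¬p = ⊥-elim (¬p p)
𝟙-no (no _)  _  = refl

𝟙-≡-subst : {A : Set} {a b : A} (a≟b : Dec (a ≡ b)) (G : A → ℚ) → 𝟙 a≟b * G a ≡ 𝟙 a≟b * G b
𝟙-≡-subst (yes refl) G = refl
𝟙-≡-subst (no _)     G = trans (ℚ.*-zeroˡ (G _)) (sym (ℚ.*-zeroˡ (G _)))

𝟙-× : {P Q R : Set} (P? : Dec P) (Q? : Dec Q) (R? : Dec R) →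
  (R → P) → (R → Q) → (P → Q → R) → 𝟙 P? * 𝟙 Q? ≡ 𝟙 R?
𝟙-× (yes p) (yes q) R? _   _   pq⇒r = sym (𝟙-yes R? (pq⇒r p q))
𝟙-× (no ¬p) Q?      R? r⇒p _   _    = trans (ℚ.*-zeroˡ (𝟙 Q?)) (sym (𝟙-no R? (¬p ∘ r⇒p)))
𝟙-× (yes _) (no ¬q) R? _   r⇒q _    = sym (𝟙-no R? (¬q ∘ r⇒q))

𝟙≤-⊔ : (m n k : ℕ) → 𝟙 (m ℕ.≤? k) * 𝟙 (n ℕ.≤? k) ≡ 𝟙 (m ⊔ n ℕ.≤? k)
𝟙≤-⊔ m n k = 𝟙-× (m ℕ.≤? k) (n ℕ.≤? k) (m ⊔ n ℕ.≤? k)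
  (ℕₚ.≤-trans (ℕₚ.m≤m⊔n m n)) (ℕₚ.≤-trans (ℕₚ.m≤n⊔m m n)) ℕₚ.⊔-lub

∑-𝟙≟-out-of-range : (B m : ℕ) (v : ℚ) → B ℕ.≤ m → ∑[ M ∈ downFrom B ] 𝟙 (m ℕ.≟ M) * v ≡ 0ℚ
∑-𝟙≟-out-of-range zero    m v B≤m = refl
∑-𝟙≟-out-of-range (suc B) m v B<m = begin
  𝟙 (m ℕ.≟ B) * v + (∑[ M ∈ downFrom B ] 𝟙 (m ℕ.≟ M) * v)
    ≡⟨ cong₂ _+_ (cong (_* v) (𝟙-no (m ℕ.≟ B) λ { refl → ℕₚ.n≮n m B<m }))
                 (∑-𝟙≟-out-of-range B m v (ℕₚ.<⇒≤ B<m)) ⟩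
  0ℚ * v + 0ℚ
    ≡⟨ trans (ℚ.+-identityʳ _) (ℚ.*-zeroˡ v) ⟩
  0ℚ ∎

∑-𝟙≟ : (B m : ℕ) (v : ℚ) → m ℕ.< B → ∑[ M ∈ downFrom B ] 𝟙 (m ℕ.≟ M) * v ≡ v
∑-𝟙≟ (suc B) m v m<1+B with m ℕ.≟ B
... | yes refl = begin
  𝟙 (m ℕ.≟ m) * v + (∑[ M ∈ downFrom m ] 𝟙 (m ℕ.≟ M) * v)
    ≡⟨ cong₂ _+_ (cong (_* v) (𝟙-yes (m ℕ.≟ m) refl)) (∑-𝟙≟-out-of-range m m v ℕₚ.≤-refl) ⟩
  1ℚ * v + 0ℚ
    ≡⟨ trans (ℚ.+-identityʳ _) (ℚ.*-identityˡ v) ⟩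
  v ∎
... | no m≢B = begin
  𝟙 (m ℕ.≟ B) * v + (∑[ M ∈ downFrom B ] 𝟙 (m ℕ.≟ M) * v)
    ≡⟨ cong₂ _+_ (cong (_* v) (𝟙-no (m ℕ.≟ B) m≢B))
                 (∑-𝟙≟ B m v (ℕₚ.≤∧≢⇒< (ℕₚ.m<1+n⇒m≤n m<1+B) m≢B)) ⟩
  0ℚ * v + v
    ≡⟨ trans (cong (_+ v) (ℚ.*-zeroˡ v)) (ℚ.+-identityˡ v) ⟩
  v ∎

∑-partition : {A : Set} (xs : List A) (κ : A → ℕ) (B : ℕ) → (∀ x → κ x ℕ.< B) → (f : A → ℚ) →
  ∑ xs f ≡ ∑[ M ∈ downFrom B ] ∑[ x ∈ xs ] 𝟙 (κ x ℕ.≟ M) * f x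
∑-partition xs κ B κ<B f =
  trans (∑-cong xs λ x → sym (∑-𝟙≟ B (κ x) (f x) (κ<B x))) (∑-comm xs (downFrom B) _)

*-nonneg : ∀ {a b} → 0ℚ ≤ a → 0ℚ ≤ b → 0ℚ ≤ a * b
*-nonneg {a} {b} 0≤a 0≤b =
  ℚ.nonNegative⁻¹ (a * b) {{ℚ.nonNeg*nonNeg⇒nonNeg a {{nonNegative 0≤a}} b {{nonNegative 0≤b}}}}

÷-*-cancel : ∀ x y .{{_ : NonZero y}} → (x ÷ y) * y ≡ x
÷-*-cancel x y = begin
  x * 1/ y * y   ≡⟨ ℚ.*-assoc x (1/ y) y ⟩
  x * (1/ y * y) ≡⟨ cong (x *_) (ℚ.*-inverseˡ y) ⟩
  x * 1ℚ         ≡⟨ ℚ.*-identityʳ x ⟩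
  x              ∎

-- x ÷₀ 0 = 0: below, a zero denominator is the mass of a null conditioning event.
_÷₀_ : ℚ → ℚ → ℚ
x ÷₀ y with y ≟ 0ℚ
... | yes _   = 0ℚ
... | no y≢0 = (x ÷ y) {{≢-nonZero y≢0}}

÷₀-*-cancel : ∀ {x y} → 0ℚ ≤ x → x ≤ y → (x ÷₀ y) * y ≡ x
÷₀-*-cancel {x} {y} 0≤x x≤y with y ≟ 0ℚ
... | yes refl = trans (ℚ.*-zeroˡ 0ℚ) (ℚ.≤-antisym 0≤x x≤y)
... | no y≢0   = ÷-*-cancel x y {{≢-nonZero y≢0}}

÷₀-bounds : ∀ {x y} → 0ℚ ≤ x → x ≤ y → 0ℚ ≤ x ÷₀ y × x ÷₀ y ≤ 1ℚ
÷₀-bounds {x} {y} 0≤x x≤y with y ≟ 0ℚ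
... | yes _   = ℚ.≤-refl , ℚ.nonNegative⁻¹ 1ℚ
... | no y≢0 =
    ℚ.*-cancelʳ-≤-pos y (subst₂ _≤_ (sym (ℚ.*-zeroˡ y)) (sym x/y*y≡x) 0≤x)
  , ℚ.*-cancelʳ-≤-pos y (subst₂ _≤_ (sym x/y*y≡x) (sym (ℚ.*-identityˡ y)) x≤y)
  where
  instance
    y>0 = ℚ.nonNeg∧nonZero⇒pos y {{nonNegative (ℚ.≤-trans 0≤x x≤y)}} {{≢-nonZero y≢0}}
  x/y*y≡x : (x ÷ y) {{≢-nonZero y≢0}} * y ≡ x
  x/y*y≡x = ÷-*-cancel x y {{≢-nonZero y≢0}}

module _ {A : Set} (xs : List A) (w v : A → ℚ) (κ : A → ℕ) where

  private
    numerator denominator : ℕ → ℚ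
    numerator   M = ∑[ x ∈ xs ] w x * (v x * 𝟙 (κ x ℕ.≟ M))
    denominator M = ∑[ x ∈ xs ] w x * 𝟙 (κ x ℕ.≟ M)

  conditionalMean : ℕ → ℚ
  conditionalMean M = numerator M ÷₀ denominator M

  module _ (w≥0 : ∀ x → 0ℚ ≤ w x) (v∈[0,1] : ∀ x → 0ℚ ≤ v x × v x ≤ 1ℚ) where

    private
      numerator-bounds : ∀ M → 0ℚ ≤ numerator M × numerator M ≤ denominator M
      numerator-bounds M =
          ∑-nonneg xs (λ x → *-nonneg (w≥0 x) (*-nonneg (proj₁ (v∈[0,1] x)) (0≤𝟙 (κ x ℕ.≟ M))))
        , ∑-mono-≤ xs (λ x → ℚ.*-monoˡ-≤-nonNeg (w x) {{nonNegative (w≥0 x)}}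
                               (*𝟙≤𝟙 (proj₂ (v∈[0,1] x)) (κ x ℕ.≟ M)))
        where
        0≤𝟙 : {P : Set} (P? : Dec P) → 0ℚ ≤ 𝟙 P?
        0≤𝟙 (yes _) = ℚ.nonNegative⁻¹ 1ℚ
        0≤𝟙 (no _)  = ℚ.≤-refl
        *𝟙≤𝟙 : ∀ {a} → a ≤ 1ℚ → {P : Set} (P? : Dec P) → a * 𝟙 P? ≤ 𝟙 P?
        *𝟙≤𝟙 {a} a≤1 (yes _) = subst₂ _≤_ (sym (ℚ.*-identityʳ a)) refl a≤1
        *𝟙≤𝟙 {a} a≤1 (no _)  = ℚ.≤-reflexive (ℚ.*-zeroʳ a)

    conditionalMean-bounds : ∀ M → 0ℚ ≤ conditionalMean M × conditionalMean M ≤ 1ℚ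
    conditionalMean-bounds M = ÷₀-bounds (proj₁ (numerator-bounds M)) (proj₂ (numerator-bounds M))

    ∑-conditionalMean : (B : ℕ) → (∀ x → κ x ℕ.< B) → (h : ℕ → ℚ) →
      ∑[ x ∈ xs ] w x * (conditionalMean (κ x) * h (κ x)) ≡ ∑[ x ∈ xs ] w x * (v x * h (κ x))
    ∑-conditionalMean B κ<B h = begin
      ∑[ x ∈ xs ] w x * (conditionalMean (κ x) * h (κ x))
        ≡⟨ ∑-partition xs κ B κ<B _ ⟩
      ∑[ M ∈ downFrom B ] ∑[ x ∈ xs ] 𝟙 (κ x ℕ.≟ M) * (w x * (conditionalMean (κ x) * h (κ x)))
        ≡⟨ ∑-cong (downFrom B) (λ M → trans (fiber-mean M) (sym (fiber-v M))) ⟩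
      ∑[ M ∈ downFrom B ] ∑[ x ∈ xs ] 𝟙 (κ x ℕ.≟ M) * (w x * (v x * h (κ x)))
        ≡⟨ sym (∑-partition xs κ B κ<B _) ⟩
      ∑[ x ∈ xs ] w x * (v x * h (κ x)) ∎
      where
      fiber-mean : ∀ M → ∑[ x ∈ xs ] 𝟙 (κ x ℕ.≟ M) * (w x * (conditionalMean (κ x) * h (κ x)))
                           ≡ h M * numerator M
      fiber-mean M = begin
        ∑[ x ∈ xs ] 𝟙 (κ x ℕ.≟ M) * (w x * (conditionalMean (κ x) * h (κ x)))
          ≡⟨ ∑-cong xs (λ x → 𝟙-≡-subst (κ x ℕ.≟ M) (λ m → w x * (conditionalMean m * h m))) ⟩
        ∑[ x ∈ xs ] 𝟙 (κ x ℕ.≟ M) * (w x * (conditionalMean M * h M))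
          ≡⟨ ∑-cong xs (λ x → rearrange (𝟙 (κ x ℕ.≟ M)) (w x) (conditionalMean M) (h M)) ⟩
        ∑[ x ∈ xs ] (h M * conditionalMean M) * (w x * 𝟙 (κ x ℕ.≟ M))
          ≡⟨ ∑-*ˡ xs (h M * conditionalMean M) _ ⟩
        (h M * conditionalMean M) * denominator M
          ≡⟨ ℚ.*-assoc (h M) _ _ ⟩
        h M * (conditionalMean M * denominator M)
          ≡⟨ cong (h M *_) (÷₀-*-cancel (proj₁ (numerator-bounds M)) (proj₂ (numerator-bounds M))) ⟩
        h M * numerator M ∎
        where
        rearrange : ∀ i a c e → i * (a * (c * e)) ≡ (e * c) * (a * i)
        rearrange i a c e = solve (i ∷ a ∷ c ∷ e ∷ []) ℚ-ring
      fiber-v : ∀ M → ∑[ x ∈ xs ] 𝟙 (κ x ℕ.≟ M) * (w x * (v x * h (κ x))) ≡ h M * numerator M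
      fiber-v M = begin
        ∑[ x ∈ xs ] 𝟙 (κ x ℕ.≟ M) * (w x * (v x * h (κ x)))
          ≡⟨ ∑-cong xs (λ x → 𝟙-≡-subst (κ x ℕ.≟ M) (λ m → w x * (v x * h m))) ⟩
        ∑[ x ∈ xs ] 𝟙 (κ x ℕ.≟ M) * (w x * (v x * h M))
          ≡⟨ ∑-cong xs (λ x → rearrange (𝟙 (κ x ℕ.≟ M)) (w x) (v x) (h M)) ⟩
        ∑[ x ∈ xs ] h M * (w x * (v x * 𝟙 (κ x ℕ.≟ M)))
          ≡⟨ ∑-*ˡ xs (h M) _ ⟩
        h M * numerator M ∎
        where
        rearrange : ∀ i a b e → i * (a * (b * e)) ≡ e * (a * (b * i))
        rearrange i a b e = solve (i ∷ a ∷ b ∷ e ∷ []) ℚ-ring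

initLast-∷ʳ : {A : Set} (xs : List A) (x : A) → initLast (xs ∷ʳ x) ≡ xs ∷ʳ′ x
initLast-∷ʳ []       x = refl
initLast-∷ʳ (y ∷ xs) x rewrite initLast-∷ʳ xs x = refl

module _ {K : ℕ} where

  ∑-allSeqs-∷ : ∀ t (f : List (Fin K) → ℚ) →
    ∑ (allSeqs K (suc t)) f ≡ ∑[ x ∈ allFin K ] ∑[ zs ∈ allSeqs K t ] f (x ∷ zs)
  ∑-allSeqs-∷ t f = trans (∑-concatMap (λ x → map (x ∷_) (allSeqs K t)) (allFin K) f)
                          (∑-cong (allFin K) λ x → ∑-map (x ∷_) (allSeqs K t) f)

  ∑-allSeqs-∷ʳ : ∀ t (f : List (Fin K) → ℚ) →
    ∑ (allSeqs K (suc t)) f ≡ ∑[ xs ∈ allSeqs K t ] ∑[ ℓ ∈ allFin K ] f (xs ∷ʳ ℓ)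
  ∑-allSeqs-∷ʳ zero f =
    trans (∑-allSeqs-∷ 0 f) (trans (∑-cong (allFin K) λ ℓ → ℚ.+-identityʳ (f [ ℓ ])) (sym (ℚ.+-identityʳ _)))
  ∑-allSeqs-∷ʳ (suc t) f = begin
    ∑ (allSeqs K (suc (suc t))) f
      ≡⟨ ∑-allSeqs-∷ (suc t) f ⟩
    ∑[ x ∈ allFin K ] ∑[ zs ∈ allSeqs K (suc t) ] f (x ∷ zs)
      ≡⟨ ∑-cong (allFin K) (λ x → ∑-allSeqs-∷ʳ t (λ zs → f (x ∷ zs))) ⟩
    ∑[ x ∈ allFin K ] ∑[ xs ∈ allSeqs K t ] ∑[ ℓ ∈ allFin K ] f (x ∷ xs ∷ʳ ℓ)
      ≡⟨ sym (∑-allSeqs-∷ t _) ⟩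
    ∑[ xs ∈ allSeqs K (suc t) ] ∑[ ℓ ∈ allFin K ] f (xs ∷ʳ ℓ) ∎

  ∑-allSeqs-length : ∀ t (G : ℕ → List (Fin K) → ℚ) →
    ∑[ xs ∈ allSeqs K t ] G (length xs) xs ≡ ∑[ xs ∈ allSeqs K t ] G t xs
  ∑-allSeqs-length zero    G = refl
  ∑-allSeqs-length (suc t) G = begin
    ∑[ xs ∈ allSeqs K (suc t) ] G (length xs) xs
      ≡⟨ ∑-allSeqs-∷ t _ ⟩
    ∑[ x ∈ allFin K ] ∑[ zs ∈ allSeqs K t ] G (suc (length zs)) (x ∷ zs)
      ≡⟨ ∑-cong (allFin K) (λ x → ∑-allSeqs-length t (λ s zs → G (suc s) (x ∷ zs))) ⟩
    ∑[ x ∈ allFin K ] ∑[ zs ∈ allSeqs K t ] G (suc t) (x ∷ zs)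
      ≡⟨ sym (∑-allSeqs-∷ t _) ⟩
    ∑[ xs ∈ allSeqs K (suc t) ] G (suc t) xs ∎

  maxSeq-++ : (xs ys : List (Fin K)) → maxSeq (xs ++ ys) ≡ maxSeq xs ⊔ maxSeq ys
  maxSeq-++ []       ys = refl
  maxSeq-++ (x ∷ xs) ys =
    trans (cong (toℕ x ⊔_) (maxSeq-++ xs ys)) (sym (ℕₚ.⊔-assoc (toℕ x) (maxSeq xs) (maxSeq ys)))

  maxSeq-∷ʳ : (xs : List (Fin K)) (ℓ : Fin K) → maxSeq (xs ∷ʳ ℓ) ≡ maxSeq xs ⊔ toℕ ℓ
  maxSeq-∷ʳ xs ℓ = trans (maxSeq-++ xs [ ℓ ]) (cong (maxSeq xs ⊔_) (ℕₚ.⊔-identityʳ (toℕ ℓ)))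

  maxSeq≤K : (xs : List (Fin K)) → maxSeq xs ℕ.≤ K
  maxSeq≤K []       = ℕ.z≤n
  maxSeq≤K (x ∷ xs) = ℕₚ.⊔-lub (ℕₚ.<⇒≤ (toℕ<n x)) (maxSeq≤K xs)

normaliser : {K : ℕ} → (Fin K → ℚ) → Fin K → ℚ
normaliser p k with cdf p k ≟ 0ℚ
... | yes _   = 0ℚ
... | no F≢0 = (1/ cdf p k) {{≢-nonZero F≢0}}

condPmf-restrict : {K : ℕ} (p : Fin K → ℚ) (k ℓ : Fin K) →
  condPmf p k ℓ ≡ normaliser p k * (𝟙 (toℕ ℓ ℕ.≤? toℕ k) * p ℓ)
condPmf-restrict p k ℓ with cdf p k ≟ 0ℚ
... | yes _ = sym (ℚ.*-zeroˡ (𝟙 (toℕ ℓ ℕ.≤? toℕ k) * p ℓ))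
... | no _  = trans (if-then-0≡𝟙* (toℕ ℓ ℕ.≤? toℕ k) _) (reorder (𝟙 (toℕ ℓ ℕ.≤? toℕ k)) (p ℓ) _)
  where
  reorder : ∀ i a c → i * (a * c) ≡ c * (i * a)
  reorder i a c = solve (i ∷ a ∷ c ∷ []) ℚ-ring

p≤1⇒0≤1-p : ∀ {a} → a ≤ 1ℚ → 0ℚ ≤ 1ℚ - a
p≤1⇒0≤1-p {a} a≤1 = subst (_≤ 1ℚ - a) (ℚ.+-inverseʳ a) (ℚ.+-monoˡ-≤ (- a) a≤1)

module Run {K : ℕ} (p : Fin K → ℚ) where

  survivalFrom : Algorithm K → List (Fin K) → List (Fin K) → ℚ
  survivalFrom b pre []       = 1ℚ
  survivalFrom b pre (x ∷ xs) = p x * (1ℚ - b (pre ∷ʳ x)) * survivalFrom b (pre ∷ʳ x) xs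

  survival : Algorithm K → List (Fin K) → ℚ
  survival b = survivalFrom b []

  survivalFrom-∷ʳ : ∀ b pre xs ℓ →
    survivalFrom b pre (xs ∷ʳ ℓ) ≡ survivalFrom b pre xs * (p ℓ * (1ℚ - b (pre ++ (xs ∷ʳ ℓ))))
  survivalFrom-∷ʳ b pre []       ℓ = trans (ℚ.*-identityʳ _) (sym (ℚ.*-identityˡ (p ℓ * (1ℚ - b (pre ∷ʳ ℓ)))))
  survivalFrom-∷ʳ b pre (x ∷ xs) ℓ = begin
    step * survivalFrom b (pre ∷ʳ x) (xs ∷ʳ ℓ)
      ≡⟨ cong (step *_) (survivalFrom-∷ʳ b (pre ∷ʳ x) xs ℓ) ⟩
    step * (survivalFrom b (pre ∷ʳ x) xs * (p ℓ * (1ℚ - b ((pre ∷ʳ x) ++ (xs ∷ʳ ℓ)))))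
      ≡⟨ sym (ℚ.*-assoc step _ _) ⟩
    step * survivalFrom b (pre ∷ʳ x) xs * (p ℓ * (1ℚ - b ((pre ∷ʳ x) ++ (xs ∷ʳ ℓ))))
      ≡⟨ cong (λ ys → step * survivalFrom b (pre ∷ʳ x) xs * (p ℓ * (1ℚ - b ys)))
              (++-assoc pre [ x ] (xs ∷ʳ ℓ)) ⟩
    step * survivalFrom b (pre ∷ʳ x) xs * (p ℓ * (1ℚ - b (pre ++ (x ∷ xs ∷ʳ ℓ)))) ∎
    where
    step : ℚ
    step = p x * (1ℚ - b (pre ∷ʳ x))

  survival-∷ʳ : ∀ b xs ℓ → survival b (xs ∷ʳ ℓ) ≡ survival b xs * (p ℓ * (1ℚ - b (xs ∷ʳ ℓ)))
  survival-∷ʳ b = survivalFrom-∷ʳ b []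

  survival-nonneg : (∀ ℓ → 0ℚ ≤ p ℓ) → ∀ {b} → ValidAlg b → ∀ xs → 0ℚ ≤ survival b xs
  survival-nonneg p≥0 {b} valid = from []
    where
    from : ∀ pre xs → 0ℚ ≤ survivalFrom b pre xs
    from pre []       = ℚ.nonNegative⁻¹ 1ℚ
    from pre (x ∷ xs) = *-nonneg (*-nonneg (p≥0 x) (p≤1⇒0≤1-p (proj₂ (valid (pre ∷ʳ x)))))
                                 (from (pre ∷ʳ x) xs)

  survivalMass : Algorithm K → ℕ → (ℕ → ℚ) → ℚ
  survivalMass b t g = ∑[ xs ∈ allSeqs K t ] survival b xs * g (maxSeq xs)

  acceptMass : Algorithm K → ℕ → (Fin K → ℕ → ℚ) → ℚ
  acceptMass b t g =
    ∑[ xs ∈ allSeqs K t ] ∑[ ℓ ∈ allFin K ] survival b xs * (p ℓ * (b (xs ∷ʳ ℓ) * g ℓ (maxSeq (xs ∷ʳ ℓ))))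

  survivalMass-next : ∀ b t (F : Fin K → ℕ → ℚ) →
    survivalMass b t (λ m → ∑[ ℓ ∈ allFin K ] p ℓ * F ℓ (m ⊔ toℕ ℓ))
      ≡ ∑[ xs ∈ allSeqs K t ] ∑[ ℓ ∈ allFin K ] survival b xs * (p ℓ * F ℓ (maxSeq (xs ∷ʳ ℓ)))
  survivalMass-next b t F = ∑-cong (allSeqs K t) λ xs →
    trans (sym (∑-*ˡ (allFin K) (survival b xs) _))
          (∑-cong (allFin K) λ ℓ → cong (λ m → survival b xs * (p ℓ * F ℓ m)) (sym (maxSeq-∷ʳ xs ℓ)))

  survivalMass-suc : ∀ b t g →
    survivalMass b (suc t) g + acceptMass b t (λ _ → g)
      ≡ survivalMass b t (λ m → ∑[ ℓ ∈ allFin K ] p ℓ * g (m ⊔ toℕ ℓ))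
  survivalMass-suc b t g = begin
    survivalMass b (suc t) g + acceptMass b t (λ _ → g)
      ≡⟨ cong (_+ acceptMass b t (λ _ → g)) (∑-allSeqs-∷ʳ t _) ⟩
    (∑[ xs ∈ allSeqs K t ] ∑[ ℓ ∈ allFin K ] survival b (xs ∷ʳ ℓ) * G xs ℓ) + acceptMass b t (λ _ → g)
      ≡⟨ sym (∑∑-+ (allSeqs K t) (allFin K) _ _) ⟩
    ∑[ xs ∈ allSeqs K t ] ∑[ ℓ ∈ allFin K ]
      (survival b (xs ∷ʳ ℓ) * G xs ℓ + survival b xs * (p ℓ * (b (xs ∷ʳ ℓ) * G xs ℓ)))
      ≡⟨ ∑-cong (allSeqs K t) (λ xs → ∑-cong (allFin K) (stop-or-continue xs)) ⟩
    ∑[ xs ∈ allSeqs K t ] ∑[ ℓ ∈ allFin K ] survival b xs * (p ℓ * G xs ℓ)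
      ≡⟨ sym (survivalMass-next b t (λ _ → g)) ⟩
    survivalMass b t (λ m → ∑[ ℓ ∈ allFin K ] p ℓ * g (m ⊔ toℕ ℓ)) ∎
    where
    G : List (Fin K) → Fin K → ℚ
    G xs ℓ = g (maxSeq (xs ∷ʳ ℓ))
    split : ∀ s a c e → s * (a * (1ℚ - c)) * e + s * (a * (c * e)) ≡ s * (a * e)
    split s a c e = solve (s ∷ a ∷ c ∷ e ∷ []) ℚ-ring
    stop-or-continue : ∀ xs ℓ →
      survival b (xs ∷ʳ ℓ) * G xs ℓ + survival b xs * (p ℓ * (b (xs ∷ʳ ℓ) * G xs ℓ))
        ≡ survival b xs * (p ℓ * G xs ℓ)
    stop-or-continue xs ℓ = trans (cong (λ s → s * G xs ℓ + survival b xs * (p ℓ * (b (xs ∷ʳ ℓ) * G xs ℓ)))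
                                        (survival-∷ʳ b xs ℓ))
                                  (split (survival b xs) (p ℓ) (b (xs ∷ʳ ℓ)) (G xs ℓ))

  winFrom : Algorithm K → (ℕ → ℚ) → List (Fin K) → ℕ → ℚ
  winFrom b h pre j = ∑[ zs ∈ allSeqs K j ]
    prodℚ (map p zs) * (h (maxSeq (pre ++ zs)) * winProb b (maxSeq (pre ++ zs)) pre zs)

  weightedSuccess : Algorithm K → (ℕ → ℚ) → ℕ → ℚ
  weightedSuccess b h = winFrom b h []

  winAfter : Algorithm K → (ℕ → ℚ) → ℕ → ℕ → ℚ
  winAfter b h t j = ∑[ pre ∈ allSeqs K t ] survival b pre * winFrom b h pre j

  -- The h-weighted chance that a value ℓ, accepted when the running maximum is M,
  -- is the overall maximum once j further values have arrived.
  winGain : (ℕ → ℚ) → ℕ → Fin K → ℕ → ℚ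
  winGain h j ℓ M = ∑[ zs ∈ allSeqs K j ]
    prodℚ (map p zs) * (h (M ⊔ maxSeq zs) * 𝟙 (toℕ ℓ ℕ.≟ M ⊔ maxSeq zs))

  winFrom-suc : ∀ b h pre j → winFrom b h pre (suc j) ≡
    ∑[ ℓ ∈ allFin K ] (p ℓ * (b (pre ∷ʳ ℓ) * winGain h j ℓ (maxSeq (pre ∷ʳ ℓ)))
                       + p ℓ * (1ℚ - b (pre ∷ʳ ℓ)) * winFrom b h (pre ∷ʳ ℓ) j)
  winFrom-suc b h pre j = trans (∑-allSeqs-∷ {K} j _) (∑-cong (allFin K) first-value)
    where
    first-value : ∀ ℓ →
      ∑[ zs ∈ allSeqs K j ] prodℚ (map p (ℓ ∷ zs))
        * (h (maxSeq (pre ++ ℓ ∷ zs)) * winProb b (maxSeq (pre ++ ℓ ∷ zs)) pre (ℓ ∷ zs))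
      ≡ p ℓ * (b (pre ∷ʳ ℓ) * winGain h j ℓ (maxSeq (pre ∷ʳ ℓ)))
        + p ℓ * (1ℚ - b (pre ∷ʳ ℓ)) * winFrom b h (pre ∷ʳ ℓ) j
    first-value ℓ = begin
      ∑[ zs ∈ allSeqs K j ] p ℓ * P zs * (h (M zs) * (
        (if does (toℕ ℓ ℕ.≟ M zs) then B else 0ℚ) + (1ℚ - B) * winProb b (M zs) (pre ∷ʳ ℓ) zs))
        ≡⟨ ∑-cong (allSeqs K j) split ⟩
      ∑[ zs ∈ allSeqs K j ] (p ℓ * (B * (P zs * (h (M₁ zs) * 𝟙 (toℕ ℓ ℕ.≟ M₁ zs))))
        + p ℓ * (1ℚ - B) * (P zs * (h (M₂ zs) * winProb b (M₂ zs) (pre ∷ʳ ℓ) zs)))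
        ≡⟨ ∑-+ (allSeqs K j) _ _ ⟩
      (∑[ zs ∈ allSeqs K j ] p ℓ * (B * (P zs * (h (M₁ zs) * 𝟙 (toℕ ℓ ℕ.≟ M₁ zs)))))
        + (∑[ zs ∈ allSeqs K j ] p ℓ * (1ℚ - B) * (P zs * (h (M₂ zs) * winProb b (M₂ zs) (pre ∷ʳ ℓ) zs)))
        ≡⟨ cong₂ _+_ (trans (∑-*ˡ (allSeqs K j) (p ℓ) _) (cong (p ℓ *_) (∑-*ˡ (allSeqs K j) B _)))
                     (∑-*ˡ (allSeqs K j) (p ℓ * (1ℚ - B)) _) ⟩
      p ℓ * (B * winGain h j ℓ (maxSeq (pre ∷ʳ ℓ))) + p ℓ * (1ℚ - B) * winFrom b h (pre ∷ʳ ℓ) j ∎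
      where
      B : ℚ
      B = b (pre ∷ʳ ℓ)
      P : List (Fin K) → ℚ
      M M₁ M₂ : List (Fin K) → ℕ
      P zs  = prodℚ (map p zs)
      M zs  = maxSeq (pre ++ ℓ ∷ zs)
      M₂ zs = maxSeq ((pre ∷ʳ ℓ) ++ zs)
      M₁ zs = maxSeq (pre ∷ʳ ℓ) ⊔ maxSeq zs
      M≡M₂ : ∀ zs → M zs ≡ M₂ zs
      M≡M₂ zs = cong maxSeq (sym (++-assoc pre [ ℓ ] zs))
      expand : ∀ a c e i s w → a * c * (e * (i * s + (1ℚ - s) * w))
                              ≡ a * (s * (c * (e * i))) + a * (1ℚ - s) * (c * (e * w))
      expand a c e i s w = solve (a ∷ c ∷ e ∷ i ∷ s ∷ w ∷ []) ℚ-ring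
      split : ∀ zs → p ℓ * P zs * (h (M zs) * ((if does (toℕ ℓ ℕ.≟ M zs) then B else 0ℚ)
                                               + (1ℚ - B) * winProb b (M zs) (pre ∷ʳ ℓ) zs))
        ≡ p ℓ * (B * (P zs * (h (M₁ zs) * 𝟙 (toℕ ℓ ℕ.≟ M₁ zs))))
          + p ℓ * (1ℚ - B) * (P zs * (h (M₂ zs) * winProb b (M₂ zs) (pre ∷ʳ ℓ) zs))
      split zs = begin
        _ ≡⟨ cong (λ a → p ℓ * P zs * (h (M zs) * (a + (1ℚ - B) * winProb b (M zs) (pre ∷ʳ ℓ) zs)))
                  (if-then-0≡𝟙* (toℕ ℓ ℕ.≟ M zs) B) ⟩
        _ ≡⟨ expand (p ℓ) (P zs) (h (M zs)) (𝟙 (toℕ ℓ ℕ.≟ M zs)) B (winProb b (M zs) (pre ∷ʳ ℓ) zs) ⟩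
        _ ≡⟨ cong₂ (λ m₁ m₂ → p ℓ * (B * (P zs * (h m₁ * 𝟙 (toℕ ℓ ℕ.≟ m₁))))
                              + p ℓ * (1ℚ - B) * (P zs * (h m₂ * winProb b m₂ (pre ∷ʳ ℓ) zs)))
                   (trans (M≡M₂ zs) (maxSeq-++ (pre ∷ʳ ℓ) zs)) (M≡M₂ zs) ⟩
        _ ∎

  winFrom-zero : ∀ b h pre → winFrom b h pre 0 ≡ 0ℚ
  winFrom-zero b h pre = vanish (h (maxSeq (pre ++ [])))
    where
    vanish : ∀ e → 1ℚ * (e * 0ℚ) + 0ℚ ≡ 0ℚ
    vanish e = solve (e ∷ []) ℚ-ring

  winAfter-zero : ∀ b h t → winAfter b h t 0 ≡ 0ℚ
  winAfter-zero b h t = trans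
    (∑-cong (allSeqs K t) λ pre →
      trans (cong (survival b pre *_) (winFrom-zero b h pre)) (ℚ.*-zeroʳ (survival b pre)))
    (∑-zero (allSeqs K t))

  winAfter-suc : ∀ b h t j → winAfter b h t (suc j) ≡ acceptMass b t (winGain h j) + winAfter b h (suc t) j
  winAfter-suc b h t j = begin
    winAfter b h t (suc j)
      ≡⟨ ∑-cong (allSeqs K t) (λ xs → trans (cong (survival b xs *_) (winFrom-suc b h xs j))
                                            (sym (∑-*ˡ (allFin K) (survival b xs) _))) ⟩
    ∑[ xs ∈ allSeqs K t ] ∑[ ℓ ∈ allFin K ] survival b xs * (A xs ℓ + C xs ℓ * W xs ℓ)
      ≡⟨ ∑-cong (allSeqs K t) (λ xs → ∑-cong (allFin K) (accept-or-continue xs)) ⟩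
    ∑[ xs ∈ allSeqs K t ] ∑[ ℓ ∈ allFin K ] (survival b xs * A xs ℓ + survival b (xs ∷ʳ ℓ) * W xs ℓ)
      ≡⟨ ∑∑-+ (allSeqs K t) (allFin K) _ _ ⟩
    acceptMass b t (winGain h j) + (∑[ xs ∈ allSeqs K t ] ∑[ ℓ ∈ allFin K ] survival b (xs ∷ʳ ℓ) * W xs ℓ)
      ≡⟨ cong (acceptMass b t (winGain h j) +_) (sym (∑-allSeqs-∷ʳ {K} t _)) ⟩
    acceptMass b t (winGain h j) + winAfter b h (suc t) j ∎
    where
    A C W : List (Fin K) → Fin K → ℚ
    A xs ℓ = p ℓ * (b (xs ∷ʳ ℓ) * winGain h j ℓ (maxSeq (xs ∷ʳ ℓ)))
    C xs ℓ = p ℓ * (1ℚ - b (xs ∷ʳ ℓ))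
    W xs ℓ = winFrom b h (xs ∷ʳ ℓ) j
    accept-or-continue : ∀ xs ℓ → survival b xs * (A xs ℓ + C xs ℓ * W xs ℓ)
                                  ≡ survival b xs * A xs ℓ + survival b (xs ∷ʳ ℓ) * W xs ℓ
    accept-or-continue xs ℓ = begin
      survival b xs * (A xs ℓ + C xs ℓ * W xs ℓ)
        ≡⟨ ℚ.*-distribˡ-+ (survival b xs) _ _ ⟩
      survival b xs * A xs ℓ + survival b xs * (C xs ℓ * W xs ℓ)
        ≡⟨ cong (survival b xs * A xs ℓ +_) (sym (ℚ.*-assoc (survival b xs) _ _)) ⟩
      survival b xs * A xs ℓ + survival b xs * C xs ℓ * W xs ℓ
        ≡⟨ cong (λ s → survival b xs * A xs ℓ + s * W xs ℓ) (sym (survival-∷ʳ b xs ℓ)) ⟩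
      survival b xs * A xs ℓ + survival b (xs ∷ʳ ℓ) * W xs ℓ ∎

  weightedSuccess≡winAfter : ∀ b h n → weightedSuccess b h n ≡ winAfter b h 0 n
  weightedSuccess≡winAfter b h n = sym (trans (ℚ.+-identityʳ _) (ℚ.*-identityˡ _))

  module _ (r : Fin K → ℚ) (c : ℚ) (k : ℕ) (r≡ : ∀ ℓ → r ℓ ≡ c * (𝟙 (toℕ ℓ ℕ.≤? k) * p ℓ)) where

    prodℚ-restrict : ∀ xs → prodℚ (map r xs) ≡ c ^ length xs * (𝟙 (maxSeq xs ℕ.≤? k) * prodℚ (map p xs))
    prodℚ-restrict []       = refl
    prodℚ-restrict (x ∷ xs) = begin
      r x * prodℚ (map r xs)
        ≡⟨ cong₂ _*_ (r≡ x) (prodℚ-restrict xs) ⟩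
      c * (𝟙 (toℕ x ℕ.≤? k) * p x) * (c ^ length xs * (𝟙 (maxSeq xs ℕ.≤? k) * prodℚ (map p xs)))
        ≡⟨ regroup c (𝟙 (toℕ x ℕ.≤? k)) (p x) (c ^ length xs) (𝟙 (maxSeq xs ℕ.≤? k)) _ ⟩
      c * c ^ length xs * (𝟙 (toℕ x ℕ.≤? k) * 𝟙 (maxSeq xs ℕ.≤? k) * (p x * prodℚ (map p xs)))
        ≡⟨ cong (λ i → c * c ^ length xs * (i * (p x * prodℚ (map p xs)))) (𝟙≤-⊔ (toℕ x) (maxSeq xs) k) ⟩
      c * c ^ length xs * (𝟙 (maxSeq (x ∷ xs) ℕ.≤? k) * prodℚ (map p (x ∷ xs))) ∎
      where
      regroup : ∀ c i a d j e → c * (i * a) * (d * (j * e)) ≡ c * d * (i * j * (a * e))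
      regroup c i a d j e = solve (c ∷ i ∷ a ∷ d ∷ j ∷ e ∷ []) ℚ-ring

    successProb-restrict : ∀ b n → successProb n b r ≡ c ^ n * weightedSuccess b (λ M → 𝟙 (M ℕ.≤? k)) n
    successProb-restrict b n = begin
      ∑[ xs ∈ allSeqs K n ] prodℚ (map r xs) * W xs
        ≡⟨ ∑-cong (allSeqs K n) (λ xs → cong (_* W xs) (prodℚ-restrict xs)) ⟩
      ∑[ xs ∈ allSeqs K n ] c ^ length xs * (I xs * P xs) * W xs
        ≡⟨ ∑-allSeqs-length n (λ s xs → c ^ s * (I xs * P xs) * W xs) ⟩
      ∑[ xs ∈ allSeqs K n ] c ^ n * (I xs * P xs) * W xs
        ≡⟨ ∑-cong (allSeqs K n) (λ xs → regroup (c ^ n) (I xs) (P xs) (W xs)) ⟩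
      ∑[ xs ∈ allSeqs K n ] c ^ n * (P xs * (I xs * W xs))
        ≡⟨ ∑-*ˡ (allSeqs K n) (c ^ n) _ ⟩
      c ^ n * weightedSuccess b (λ M → 𝟙 (M ℕ.≤? k)) n ∎
      where
      I P W : List (Fin K) → ℚ
      I xs = 𝟙 (maxSeq xs ℕ.≤? k)
      P xs = prodℚ (map p xs)
      W xs = winProb b (maxSeq xs) [] xs
      regroup : ∀ d i a w → d * (i * a) * w ≡ d * (a * (i * w))
      regroup d i a w = solve (d ∷ i ∷ a ∷ w ∷ []) ℚ-ring

module Averaging {K : ℕ} (p : Fin K → ℚ) (p≥0 : ∀ ℓ → 0ℚ ≤ p ℓ)
                 (acc : Algorithm K) (valid : ValidAlg acc) where
  open Run p

  meanAcceptance : ℕ → Fin K → ℕ → ℚ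
  meanAcceptance t ℓ =
    conditionalMean (allSeqs K t) (survival acc) (λ pre → acc (pre ∷ʳ ℓ)) (λ pre → maxSeq (pre ∷ʳ ℓ))

  meanAcceptance-bounds : ∀ t ℓ M → 0ℚ ≤ meanAcceptance t ℓ M × meanAcceptance t ℓ M ≤ 1ℚ
  meanAcceptance-bounds t ℓ =
    conditionalMean-bounds (allSeqs K t) (survival acc) (λ pre → acc (pre ∷ʳ ℓ)) (λ pre → maxSeq (pre ∷ʳ ℓ))
                           (survival-nonneg p≥0 valid) (λ pre → valid (pre ∷ʳ ℓ))

  averaged : Algorithm K
  averaged xs with initLast xs
  ... | []        = 0ℚ
  ... | pre ∷ʳ′ ℓ = meanAcceptance (length pre) ℓ (maxSeq (pre ∷ʳ ℓ))

  averaged-∷ʳ : ∀ pre ℓ → averaged (pre ∷ʳ ℓ) ≡ meanAcceptance (length pre) ℓ (maxSeq (pre ∷ʳ ℓ))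
  averaged-∷ʳ pre ℓ rewrite initLast-∷ʳ pre ℓ = refl

  averaged-valid : ValidAlg averaged
  averaged-valid xs with initLast xs
  ... | []        = ℚ.≤-refl , ℚ.nonNegative⁻¹ 1ℚ
  ... | pre ∷ʳ′ ℓ = meanAcceptance-bounds (length pre) ℓ (maxSeq (pre ∷ʳ ℓ))

  averaged-minorOblivious : ∀ n → MinorOblivious n averaged
  averaged-minorOblivious n xs ys ℓ |xs|≡|ys| _ max-xs max-ys = begin
    averaged (xs ∷ʳ ℓ)                                         ≡⟨ averaged-∷ʳ xs ℓ ⟩
    meanAcceptance (length xs) ℓ (maxSeq (xs ∷ʳ ℓ))
      ≡⟨ cong₂ (λ t M → meanAcceptance t ℓ M) |xs|≡|ys| (trans max-xs (sym max-ys)) ⟩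
    meanAcceptance (length ys) ℓ (maxSeq (ys ∷ʳ ℓ))            ≡⟨ sym (averaged-∷ʳ ys ℓ) ⟩
    averaged (ys ∷ʳ ℓ)                                         ∎

  acceptMass-averaged : ∀ t → (∀ g → survivalMass averaged t g ≡ survivalMass acc t g) →
    ∀ g → acceptMass averaged t g ≡ acceptMass acc t g
  acceptMass-averaged t same g = begin
    acceptMass averaged t g
      ≡⟨ ∑-cong (allSeqs K t) (λ xs → ∑-cong (allFin K) λ ℓ →
           cong (λ a → survival averaged xs * (p ℓ * (a * g ℓ (maxSeq (xs ∷ʳ ℓ))))) (averaged-∷ʳ xs ℓ)) ⟩
    ∑[ xs ∈ allSeqs K t ] ∑[ ℓ ∈ allFin K ] survival averaged xs * (p ℓ * F (length xs) ℓ (maxSeq (xs ∷ʳ ℓ)))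
      ≡⟨ ∑-allSeqs-length t (λ s xs →
           ∑[ ℓ ∈ allFin K ] survival averaged xs * (p ℓ * F s ℓ (maxSeq (xs ∷ʳ ℓ)))) ⟩
    ∑[ xs ∈ allSeqs K t ] ∑[ ℓ ∈ allFin K ] survival averaged xs * (p ℓ * F t ℓ (maxSeq (xs ∷ʳ ℓ)))
      ≡⟨ sym (survivalMass-next averaged t (F t)) ⟩
    survivalMass averaged t (λ m → ∑[ ℓ ∈ allFin K ] p ℓ * F t ℓ (m ⊔ toℕ ℓ))
      ≡⟨ same (λ m → ∑[ ℓ ∈ allFin K ] p ℓ * F t ℓ (m ⊔ toℕ ℓ)) ⟩
    survivalMass acc t (λ m → ∑[ ℓ ∈ allFin K ] p ℓ * F t ℓ (m ⊔ toℕ ℓ))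
      ≡⟨ survivalMass-next acc t (F t) ⟩
    ∑[ xs ∈ allSeqs K t ] ∑[ ℓ ∈ allFin K ] survival acc xs * (p ℓ * F t ℓ (maxSeq (xs ∷ʳ ℓ)))
      ≡⟨ ∑-comm-* (allSeqs K t) (allFin K) (survival acc) p _ ⟩
    ∑[ ℓ ∈ allFin K ] p ℓ * (∑[ xs ∈ allSeqs K t ] survival acc xs * F t ℓ (maxSeq (xs ∷ʳ ℓ)))
      ≡⟨ ∑-cong (allFin K) (λ ℓ → cong (p ℓ *_) (tower ℓ)) ⟩
    ∑[ ℓ ∈ allFin K ] p ℓ * (∑[ xs ∈ allSeqs K t ] survival acc xs * (acc (xs ∷ʳ ℓ) * g ℓ (maxSeq (xs ∷ʳ ℓ))))
      ≡⟨ sym (∑-comm-* (allSeqs K t) (allFin K) (survival acc) p _) ⟩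
    acceptMass acc t g ∎
    where
    F : ℕ → Fin K → ℕ → ℚ
    F s ℓ M = meanAcceptance s ℓ M * g ℓ M
    tower : ∀ ℓ → ∑[ xs ∈ allSeqs K t ] survival acc xs * F t ℓ (maxSeq (xs ∷ʳ ℓ))
                ≡ ∑[ xs ∈ allSeqs K t ] survival acc xs * (acc (xs ∷ʳ ℓ) * g ℓ (maxSeq (xs ∷ʳ ℓ)))
    tower ℓ = ∑-conditionalMean (allSeqs K t) (survival acc) (λ xs → acc (xs ∷ʳ ℓ)) (λ xs → maxSeq (xs ∷ʳ ℓ))
                (survival-nonneg p≥0 valid) (λ xs → valid (xs ∷ʳ ℓ))
                (suc K) (λ xs → ℕ.s≤s (maxSeq≤K (xs ∷ʳ ℓ))) (g ℓ)

  survivalMass-averaged : ∀ t g → survivalMass averaged t g ≡ survivalMass acc t g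
  survivalMass-averaged zero    g = refl
  survivalMass-averaged (suc t) g =
    ∙-cancelʳ (acceptMass acc t (λ _ → g))
              (survivalMass averaged (suc t) g) (survivalMass acc (suc t) g) (begin
    survivalMass averaged (suc t) g + acceptMass acc t (λ _ → g)
      ≡⟨ cong (survivalMass averaged (suc t) g +_)
              (sym (acceptMass-averaged t (survivalMass-averaged t) (λ _ → g))) ⟩
    survivalMass averaged (suc t) g + acceptMass averaged t (λ _ → g)
      ≡⟨ survivalMass-suc averaged t g ⟩
    survivalMass averaged t (λ m → ∑[ ℓ ∈ allFin K ] p ℓ * g (m ⊔ toℕ ℓ))
      ≡⟨ survivalMass-averaged t (λ m → ∑[ ℓ ∈ allFin K ] p ℓ * g (m ⊔ toℕ ℓ)) ⟩
    survivalMass acc t (λ m → ∑[ ℓ ∈ allFin K ] p ℓ * g (m ⊔ toℕ ℓ))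
      ≡⟨ sym (survivalMass-suc acc t g) ⟩
    survivalMass acc (suc t) g + acceptMass acc t (λ _ → g) ∎)

  winAfter-averaged : ∀ h j t → winAfter averaged h t j ≡ winAfter acc h t j
  winAfter-averaged h zero    t = trans (winAfter-zero averaged h t) (sym (winAfter-zero acc h t))
  winAfter-averaged h (suc j) t = begin
    winAfter averaged h t (suc j)
      ≡⟨ winAfter-suc averaged h t j ⟩
    acceptMass averaged t (winGain h j) + winAfter averaged h (suc t) j
      ≡⟨ cong₂ _+_ (acceptMass-averaged t (survivalMass-averaged t) (winGain h j))
                   (winAfter-averaged h j (suc t)) ⟩
    acceptMass acc t (winGain h j) + winAfter acc h (suc t) j
      ≡⟨ sym (winAfter-suc acc h t j) ⟩
    winAfter acc h t (suc j) ∎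

  weightedSuccess-averaged : ∀ h n → weightedSuccess averaged h n ≡ weightedSuccess acc h n
  weightedSuccess-averaged h n = begin
    weightedSuccess averaged h n ≡⟨ weightedSuccess≡winAfter averaged h n ⟩
    winAfter averaged h 0 n      ≡⟨ winAfter-averaged h n 0 ⟩
    winAfter acc h 0 n           ≡⟨ sym (weightedSuccess≡winAfter acc h n) ⟩
    weightedSuccess acc h n      ∎

  successProb-averaged : ∀ n k → successProb n averaged (condPmf p k) ≡ successProb n acc (condPmf p k)
  successProb-averaged n k = begin
    successProb n averaged (condPmf p k)        ≡⟨ restrict averaged n ⟩
    c ^ n * weightedSuccess averaged below-k n  ≡⟨ cong (c ^ n *_) (weightedSuccess-averaged below-k n) ⟩
    c ^ n * weightedSuccess acc below-k n       ≡⟨ sym (restrict acc n) ⟩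
    successProb n acc (condPmf p k)             ∎
    where
    c : ℚ
    c = normaliser p k
    below-k : ℕ → ℚ
    below-k M = 𝟙 (M ℕ.≤? toℕ k)
    restrict : ∀ b n → successProb n b (condPmf p k) ≡ c ^ n * weightedSuccess b below-k n
    restrict = successProb-restrict (condPmf p k) c (toℕ k) (condPmf-restrict p k)

Guarantees-transfer : ∀ {K} (n : ℕ) (D : Distribution K) {α β} {acc acc′ : Algorithm K} →
  (∀ k → successProb n acc′ (condPmf (Distribution.pmf D) k)
        ≡ successProb n acc (condPmf (Distribution.pmf D) k)) →
  Guarantees n D α β acc → Guarantees n D α β acc′
Guarantees-transfer n D {α} {β} same guarantees k =
    (λ last  → subst (α ≤_) (sym (same k)) (proj₁ (guarantees k) last))
  , (λ below → subst (β ≤_) (sym (same k)) (proj₂ (guarantees k) below))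

proposition29 : (n K : ℕ) (D : Distribution K) (α β : ℚ) (acc : Algorithm K) →
    ValidAlg acc → Guarantees n D α β acc →
    Σ (Algorithm K) (λ acc′ → ValidAlg acc′ × MinorOblivious n acc′ × Guarantees n D α β acc′)
proposition29 n K D α β acc valid guarantees =
    averaged
  , averaged-valid
  , averaged-minorOblivious n
  , Guarantees-transfer n D (successProb-averaged n) guarantees
  where open Averaging (Distribution.pmf D) (Distribution.nonneg D) acc valid
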